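{- Let $T$ be a finite Church-Rosser Thue system over $\Sigma$ and let $u_1,\dots,u_n$ be strings, irreducible modulo $T$, lying in $L$, such that $L=[u_1]_T\cup\dots\cup[u_n]_T$. Then $T$ refines $S$: for all $x,y\in\Sigma^*$, $x\overset{*}{\leftrightarrow}_T y$ implies $x\overset{*}{\leftrightarrow}_S y$.
   Context: $\Sigma=\{a,b,\overline{a},\overline{b}\}$, $\lambda$ the empty string. $S$ is the Thue system with rules $(a\overline{a},\lambda),(\overline{a}a,\lambda),(a\overline{b},\lambda),(\overline{b}a,\lambda),(b\overline{a},\lambda),(\overline{a}b,\lambda),(b\overline{b},\lambda),(\overline{b}b,\lambda),(a,b),(b,a),(\overline{a},\overline{b}),(\overline{b},\overline{a})$, and $L=[\lambda]_S$, i.e. the set of strings with equally many letters from $\{a,b\}$ as from $\{\overline{a},\overline{b}\}$. For a Thue system $T$ (pairs $(u,w)$ with $|u|\ge|w|$): $x\leftrightarrow_T y$ if $x=tuv$, $y=twv$ with $(u,w)$ or $(w,u)\in T$; $\overset{*}{\leftrightarrow}_T$ its reflexive-transitive closure; $[x]_T$ the class of $x$; $x\to_T y$ means $x\leftrightarrow_T y$ with $|x|>|y|$; a string is irreducible modulo $T$ if no $\to_T$ step applies. $T$ is Church-Rosser if $x\overset{*}{\leftrightarrow}_T y$ implies a common $z$ with $x\overset{*}{\to}_T z$, $y\overset{*}{\to}_T z$. -}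

module Defs where

open import Data.List using (List; []; _∷_; _++_; length)
open import Data.List.Membership.Propositional using (_∈_)
open import Data.List.Relation.Unary.All using (All)
open import Data.List.Relation.Unary.Any using (Any)
open import Data.Nat using (ℕ; _≤_; _<_)
open import Data.Product using (_×_; _,_; ∃; ∃-syntax; Σ; proj₁; proj₂)
open import Data.Sum using (_⊎_)
open import Relation.Nullary using (¬_)
open import Relation.Binary.PropositionalEquality using (_≡_)
open import Relation.Binary.Construct.Closure.ReflexiveTransitive using (Star)

-- The alphabet Σ = {a, b, ā, b̄}
data Sym : Set where
  a b a' b' : Sym

Str : Set
Str = List Sym

λs : Str
λs = []

Rule : Set
Rule = Str × Str

ThueSystem : Set
ThueSystem = List Rule

WellOriented : ThueSystem → Set
WellOriented T = All (λ r → length (proj₂ r) ≤ length (proj₁ r)) T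

data Step (T : ThueSystem) : Str → Str → Set where
  fwd : ∀ {u w} t v → (u , w) ∈ T → Step T (t ++ u ++ v) (t ++ w ++ v)
  bwd : ∀ {u w} t v → (u , w) ∈ T → Step T (t ++ w ++ v) (t ++ u ++ v)

Conv : ThueSystem → Str → Str → Set
Conv T = Star (Step T)

InClass : ThueSystem → Str → Str → Set
InClass T x y = Conv T x y

Red : ThueSystem → Str → Str → Set
Red T x y = Step T x y × length y < length x

RedStar : ThueSystem → Str → Str → Set
RedStar T = Star (Red T)

Irreducible : ThueSystem → Str → Set
Irreducible T x = ∀ y → ¬ Red T x y

ChurchRosser : ThueSystem → Set
ChurchRosser T = ∀ x y → Conv T x y → ∃[ z ] (RedStar T x z × RedStar T y z)

S : ThueSystem
S = (a ∷ a' ∷ [] , []) ∷ (a' ∷ a ∷ [] , []) ∷ (a ∷ b' ∷ [] , []) ∷ (b' ∷ a ∷ [] , [])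
  ∷ (b ∷ a' ∷ [] , []) ∷ (a' ∷ b ∷ [] , []) ∷ (b ∷ b' ∷ [] , []) ∷ (b' ∷ b ∷ [] , [])
  ∷ (a ∷ [] , b ∷ []) ∷ (b ∷ [] , a ∷ []) ∷ (a' ∷ [] , b' ∷ []) ∷ (b' ∷ [] , a' ∷ [])
  ∷ []

InL : Str → Set
InL x = InClass S λs x

Refines : ThueSystem → ThueSystem → Set
Refines T S′ = ∀ x y → Conv T x y → Conv S′ x y

-- Modulo S every string x has the inverse x⁻¹ = reverse (map bar x), i.e. x x⁻¹ and x⁻¹ x lie in L.
-- If x ↔*_T y, then x x⁻¹ ↔*_T y x⁻¹; as L is a union of T-classes and x x⁻¹ ∈ L, also y x⁻¹ ∈ L.
-- Hence x ↔*_S y x⁻¹ x ↔*_S y.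
module Submission where

open import Defs
open import Data.List using (List; []; _∷_; _++_; _∷ʳ_; map; reverse)
open import Data.List.Properties using (++-assoc; ++-identityʳ; map-∘; map-id; map-cong; reverse-map; reverse-involutive; unfold-reverse)
open import Data.List.Relation.Unary.All using (All)
open import Data.List.Relation.Unary.Any as Any using (Any; here; there)
open import Data.Product using (_×_)
open import Function.Bundles using (_⇔_; Equivalence)
open import Relation.Binary.PropositionalEquality using (_≡_; refl; sym; cong; subst; subst₂; module ≡-Reasoning)
open import Relation.Binary.Construct.Closure.ReflexiveTransitive using (ε; _◅_; _◅◅_; gmap)
  renaming (reverse to Star-reverse)
open import Relation.Binary.Construct.Closure.ReflexiveTransitive.Properties using (module StarReasoning)

private
  reassociate : ∀ (p t z v q : Str) → (p ++ t) ++ z ++ v ++ q ≡ p ++ (t ++ z ++ v) ++ q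
  reassociate p t z v q = begin
    (p ++ t) ++ z ++ v ++ q    ≡⟨ ++-assoc p t (z ++ v ++ q) ⟩
    p ++ t ++ z ++ v ++ q      ≡⟨ cong (λ w → p ++ t ++ w) (++-assoc z v q) ⟨
    p ++ t ++ (z ++ v) ++ q    ≡⟨ cong (p ++_) (++-assoc t (z ++ v) q) ⟨
    p ++ (t ++ z ++ v) ++ q    ∎
    where open ≡-Reasoning

Step-context : ∀ {T x y} → Step T x y → ∀ p q → Step T (p ++ x ++ q) (p ++ y ++ q)
Step-context (fwd {u} {w} t v r) p q =
  subst₂ (Step _) (reassociate p t u v q) (reassociate p t w v q) (fwd (p ++ t) (v ++ q) r)
Step-context (bwd {u} {w} t v r) p q =
  subst₂ (Step _) (reassociate p t w v q) (reassociate p t u v q) (bwd (p ++ t) (v ++ q) r)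

Conv-context : ∀ {T x y} → Conv T x y → ∀ p q → Conv T (p ++ x ++ q) (p ++ y ++ q)
Conv-context c p q = gmap (λ z → p ++ z ++ q) (λ s → Step-context s p q) c

Step-sym : ∀ {T x y} → Step T x y → Step T y x
Step-sym (fwd t v r) = bwd t v r
Step-sym (bwd t v r) = fwd t v r

Conv-sym : ∀ {T x y} → Conv T x y → Conv T y x
Conv-sym = Star-reverse Step-sym

bar : Sym → Sym
bar a  = a'
bar b  = b'
bar a' = a
bar b' = b

bar-involutive : ∀ s → bar (bar s) ≡ s
bar-involutive a  = refl
bar-involutive b  = refl
bar-involutive a' = refl
bar-involutive b' = refl

inverse : Str → Str
inverse x = reverse (map bar x)

inverse-involutive : ∀ x → inverse (inverse x) ≡ x
inverse-involutive x = begin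
  reverse (map bar (reverse (map bar x)))  ≡⟨ cong reverse (reverse-map bar (map bar x)) ⟩
  reverse (reverse (map bar (map bar x)))  ≡⟨ reverse-involutive (map bar (map bar x)) ⟩
  map bar (map bar x)                      ≡⟨ sym (map-∘ x) ⟩
  map (λ s → bar (bar s)) x                ≡⟨ map-cong bar-involutive x ⟩
  map (λ s → s) x                          ≡⟨ map-id x ⟩
  x                                        ∎
  where open ≡-Reasoning

S-introduce-letter : ∀ s → Conv S [] (s ∷ bar s ∷ [])
S-introduce-letter a  = bwd [] [] (here refl) ◅ ε
S-introduce-letter a' = bwd [] [] (there (here refl)) ◅ ε
S-introduce-letter b  = bwd [] [] (there (there (there (there (there (there (here refl))))))) ◅ ε
S-introduce-letter b' = bwd [] [] (there (there (there (there (there (there (there (here refl)))))))) ◅ ε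

InL-++-inverseʳ : ∀ x → InL (x ++ inverse x)
InL-++-inverseʳ []      = ε
InL-++-inverseʳ (s ∷ x) = begin
  []                                       ⟶*⟨ S-introduce-letter s ⟩
  (s ∷ []) ++ [] ++ (bar s ∷ [])           ⟶*⟨ Conv-context (InL-++-inverseʳ x) (s ∷ []) (bar s ∷ []) ⟩
  s ∷ (x ++ inverse x) ++ (bar s ∷ [])     ≡⟨ cong (s ∷_) (++-assoc x (inverse x) (bar s ∷ [])) ⟩
  s ∷ x ++ inverse x ∷ʳ bar s              ≡⟨ cong (λ z → s ∷ x ++ z) (sym (unfold-reverse (bar s) (map bar x))) ⟩
  s ∷ x ++ inverse (s ∷ x)                 ∎
  where open StarReasoning (Step S)

InL-inverse-++ˡ : ∀ x → InL (inverse x ++ x)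
InL-inverse-++ˡ x =
  subst (λ z → InL (inverse x ++ z)) (inverse-involutive x) (InL-++-inverseʳ (inverse x))

InL-saturated : ThueSystem → Set
InL-saturated T = ∀ {x y} → Conv T x y → InL x → InL y

InL-saturated-if-union-of-classes : ∀ {T us} →
  (∀ x → InL x ⇔ Any (λ u → InClass T u x) us) → InL-saturated T
InL-saturated-if-union-of-classes iff x↔y x∈L =
  Equivalence.from (iff _) (Any.map (_◅◅ x↔y) (Equivalence.to (iff _) x∈L))

Refines-S-if-InL-saturated : ∀ {T} → InL-saturated T → Refines T S
Refines-S-if-InL-saturated saturated x y x↔y = begin
  [] ++ [] ++ x                ⟶*⟨ Conv-context yx⁻¹∈L [] x ⟩
  [] ++ (y ++ inverse x) ++ x  ≡⟨ ++-assoc y (inverse x) x ⟩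
  y ++ inverse x ++ x          ≡⟨ cong (y ++_) (sym (++-identityʳ (inverse x ++ x))) ⟩
  y ++ (inverse x ++ x) ++ []  ⟶*⟨ Conv-sym (Conv-context (InL-inverse-++ˡ x) y []) ⟩
  y ++ [] ++ []                ≡⟨ ++-identityʳ y ⟩
  y                            ∎
  where
  open StarReasoning (Step S)
  yx⁻¹∈L : InL (y ++ inverse x)
  yx⁻¹∈L = saturated (Conv-context x↔y [] (inverse x)) (InL-++-inverseʳ x)

mainTheorem5 : (T : ThueSystem) → WellOriented T → ChurchRosser T →
    (us : List Str) → All (λ u → Irreducible T u × InL u) us →
    (∀ x → InL x ⇔ Any (λ u → InClass T u x) us) →
    Refines T S
mainTheorem5 _ _ _ _ _ iff = Refines-S-if-InL-saturated (InL-saturated-if-union-of-classes iff)
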